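{- Let $\Gamma$ be a graph and $v_0,v_1$ vertices of $\Gamma$. Then the posets $\mathbf{QD}_{v_0}(\Gamma)$ and $\mathbf{QD}_{v_1}(\Gamma)$ are isomorphic.
   Context: Graphs are finite, loops and multiple edges allowed, with weights $w\colon V(\Gamma)\to\mathbb Z_{\ge0}$ and genus $g=b_1(\Gamma)+\sum w(v)$; $\mathrm{val}(v)$ counts loops twice. For $\mathcal E\subset E(\Gamma)$, $\Gamma^{\mathcal E}$ is obtained by inserting one vertex $v_e$ in each $e\in\mathcal E$. A pseudo-divisor is $(\mathcal E,D)$ with $D\colon V(\Gamma^{\mathcal E})\to\mathbb Z$, $D(v_e)=1$ for $e\in\mathcal E$. Order: $(\mathcal E,D)\ge(\mathcal E',D')$ iff $\mathcal E'\subset\mathcal E$ and there is $\varphi\colon\mathcal E\setminus\mathcal E'\to V(\Gamma)$, $\varphi(e)$ an end-vertex of $e$, with $D'(v)=D(v)+|\varphi^{ -1}(v)|$ for $v\in V(\Gamma)$. Canonical polarization: $\mu(v)=w(v)-1+\mathrm{val}(v)/2$ on $V(\Gamma)$, $0$ on exceptional vertices. $(\mathcal E,D)$ of degree $g-1$ is $v_0$-quasistable if $D(V)-\mu(V)+\delta_V/2\ge0$ for all nonempty $V\subset V(\Gamma^{\mathcal E})$, strictly when $v_0\notin V$ ($\delta_V$ = number of edges of $\Gamma^{\mathcal E}$ between $V$ and its complement). $\mathbf{QD}_{v_0}(\Gamma)$ is the poset of $v_0$-quasistable pseudo-divisors. -}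

module Defs where

open import Data.Nat as ℕ using (ℕ; zero; suc; _<ᵇ_)
open import Data.Integer as ℤ using (ℤ; +_; _+_; _-_; _*_; _≤_; _<_)
open import Data.Bool using (Bool; true; false; _∧_; _∨_; not; if_then_else_)
open import Data.Fin using (Fin; toℕ) renaming (zero to fz; suc to fs)
open import Data.Fin.Properties using () renaming (_≟_ to _≟ᶠ_)
open import Data.Vec using (Vec; lookup)
open import Data.Product using (Σ; ∃; _×_; _,_; proj₁)
open import Relation.Nullary.Decidable using (⌊_⌋)
open import Relation.Binary.PropositionalEquality using (_≡_)

sumFin : (k : ℕ) → (Fin k → ℤ) → ℤ
sumFin zero    f = + 0
sumFin (suc k) f = f fz + sumFin k (λ i → f (fs i))

anyFin : (k : ℕ) → (Fin k → Bool) → Bool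
anyFin zero    f = false
anyFin (suc k) f = f fz ∨ anyFin k (λ i → f (fs i))

[_] : Bool → ℤ
[ true ]  = + 1
[ false ] = + 0

countFin : (k : ℕ) → (Fin k → Bool) → ℤ
countFin k p = sumFin k (λ i → [ p i ])

_==_ : ∀ {k} → Fin k → Fin k → Bool
i == j = ⌊ i ≟ᶠ j ⌋

_≠ᵇ_ : Bool → Bool → Bool
true  ≠ᵇ b = not b
false ≠ᵇ b = b

-- Graphs: finite, loops and multiple edges allowed, vertex weights. Orientation is irrelevant.

record Graph : Set where
  field
    nV  : ℕ
    nE  : ℕ
    src : Fin nE → Fin nV
    tgt : Fin nE → Fin nV
    w   : Fin nV → ℕ

module _ (Γ : Graph) where
  open Graph Γ

  -- valence: number of edge-ends at v (loops counted twice)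
  val : Fin nV → ℤ
  val v = sumFin nE (λ e → [ src e == v ] + [ tgt e == v ])

  -- twice the canonical polarization on V(Γ): 2μ(v) = 2w(v) - 2 + val(v)
  twoμ : Fin nV → ℤ
  twoμ v = + 2 * + (w v) - + 2 + val v

  reach : ℕ → Fin nV → Fin nV → Bool
  reach zero    u v = u == v
  reach (suc k) u v = reach k u v ∨ anyFin nE (λ e →
      (reach k u (src e) ∧ (tgt e == v)) ∨ (reach k u (tgt e) ∧ (src e == v)))

  -- v is the least vertex (in Fin order) of its connected component
  isRep : Fin nV → Bool
  isRep v = not (anyFin nV (λ u → (toℕ u <ᵇ toℕ v) ∧ reach nV u v))

  components : ℤ
  components = countFin nV isRep

  b₁ : ℤ
  b₁ = + nE - + nV + components

  genus : ℤ
  genus = b₁ + sumFin nV (λ v → + (w v))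

  -- Pseudo-divisors (ℰ, D): ℰ ⊆ E(Γ) as a Boolean vector; D is given on
  -- V(Γ), and D(v_e) = 1 on the exceptional vertices v_e, e ∈ ℰ.

  record PseudoDivisor : Set where
    constructor pd
    field
      ℰ : Vec Bool nE
      D : Vec ℤ nV

  open PseudoDivisor public

  degree : PseudoDivisor → ℤ
  degree P = sumFin nV (λ v → lookup (D P) v) + countFin nE (λ e → lookup (ℰ P) e)

  -- A subset V ⊆ V(Γ^ℰ): S ⊆ V(Γ), T ⊆ ℰ (exceptional vertices v_e)
  record VSubset (P : PseudoDivisor) : Set where
    field
      S   : Fin nV → Bool
      T   : Fin nE → Bool
      T⊆ℰ : ∀ e → T e ≡ true → lookup (ℰ P) e ≡ true
      nonempty : (anyFin nV S ∨ anyFin nE T) ≡ true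

  -- δ_V: edges of Γ^ℰ between V and its complement. An edge e ∉ ℰ
  -- joins src e, tgt e; an edge e ∈ ℰ is replaced by src e — v_e — tgt e.
  δ : (P : PseudoDivisor) → VSubset P → ℤ
  δ P V = sumFin nE (λ e →
      if lookup (ℰ P) e
      then [ S (src e) ≠ᵇ T e ] + [ S (tgt e) ≠ᵇ T e ]
      else [ S (src e) ≠ᵇ S (tgt e) ])
    where open VSubset V

  -- D(V) and 2μ(V)  (μ = 0 on exceptional vertices)
  DV : (P : PseudoDivisor) → VSubset P → ℤ
  DV P V = sumFin nV (λ v → if S v then lookup (D P) v else + 0) + countFin nE T
    where open VSubset V

  twoμV : (P : PseudoDivisor) → VSubset P → ℤ
  twoμV P V = sumFin nV (λ v → if S v then twoμ v else + 0)
    where open VSubset V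

  -- v₀-quasistability, multiplied by 2 to stay integral:
  -- 2D(V) - 2μ(V) + δ_V ≥ 0, and > 0 when v₀ ∉ V.
  IsQuasistable : Fin nV → PseudoDivisor → Set
  IsQuasistable v₀ P =
    (degree P ≡ genus - + 1) ×
    ((V : VSubset P) →
      let x = + 2 * DV P V - twoμV P V + δ P V in
      if VSubset.S V v₀ then + 0 ≤ x else + 0 < x)

  QD : Fin nV → Set
  QD v₀ = Σ PseudoDivisor (IsQuasistable v₀)

  -- Order: P ≥ P' iff ℰ' ⊆ ℰ and there is φ : ℰ ∖ ℰ' → V(Γ) choosing an
  -- end-vertex of each edge (φ e = src e if c e = true, tgt e otherwise),
  -- with D'(v) = D(v) + |φ⁻¹(v)|.
  _≥PD_ : PseudoDivisor → PseudoDivisor → Set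
  P ≥PD P' =
    (∀ e → lookup (ℰ P') e ≡ true → lookup (ℰ P) e ≡ true) ×
    ∃ λ (c : Fin nE → Bool) → ∀ v →
      lookup (D P') v ≡ lookup (D P) v +
        countFin nE (λ e → lookup (ℰ P) e ∧ not (lookup (ℰ P') e) ∧
                           ((if c e then src e else tgt e) == v))

  -- Isomorphism of the posets QD_{v₀}(Γ) and QD_{v₁}(Γ): mutually inverse
  -- maps (elements identified by their underlying pseudo-divisor) which
  -- preserve and reflect the order.
  record QDIso (v₀ v₁ : Fin nV) : Set where
    field
      to   : QD v₀ → QD v₁
      from : QD v₁ → QD v₀
      from∘to : ∀ x → proj₁ (from (to x)) ≡ proj₁ x
      to∘from : ∀ y → proj₁ (to (from y)) ≡ proj₁ y
      to-mono : ∀ x y → proj₁ x ≥PD proj₁ y → proj₁ (to x) ≥PD proj₁ (to y)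
      to-refl : ∀ x y → proj₁ (to x) ≥PD proj₁ (to y) → proj₁ x ≥PD proj₁ y

{-# OPTIONS --safe #-}
-- Moving one unit of degree from v₁ to v₀ is the isomorphism.  For fixed V the
-- quantity 2D(V) − 2μ(V) + δ_V is even: modulo 2, the valences in 2μ(V) and
-- the edges leaving V both count the edge-ends at vertices of V.  The move
-- changes this quantity by 2([v₀ ∈ V] − [v₁ ∈ V]), and by evenness a strict
-- inequality loses nothing when it drops by 2.
module Submission where

open import Defs
open import Data.Nat as ℕ using (zero; suc)
open import Data.Integer as ℤ using (ℤ; +_; -[1+_]; _+_; _-_; _*_; _≤_; _<_)
import Data.Integer.Properties as ℤP
open import Algebra.Properties.CommutativeSemigroup ℤP.+-commutativeSemigroup
  using (interchange; xy∙z≈xz∙y)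
open import Data.Integer.Tactic.RingSolver using (solve-∀)
open import Data.Bool using (Bool; true; false; _∧_; not; if_then_else_)
open import Data.Fin using (Fin) renaming (zero to fz; suc to fs)
open import Data.Fin.Properties using () renaming (_≟_ to _≟ᶠ_)
open import Data.Vec using (lookup; tabulate)
open import Data.Vec.Properties using (lookup∘tabulate; tabulate∘lookup; tabulate-cong)
open import Data.Product using (∃-syntax; _,_; proj₁; proj₂)
open import Relation.Binary.PropositionalEquality hiding ([_])
open import Relation.Nullary using (yes; no)
open import Function using (_∘_)
open ≡-Reasoning

sumFin-cong : ∀ k {f g : Fin k → ℤ} → (∀ i → f i ≡ g i) → sumFin k f ≡ sumFin k g
sumFin-cong zero    f≡g = refl
sumFin-cong (suc k) f≡g = cong₂ _+_ (f≡g fz) (sumFin-cong k (λ i → f≡g (fs i)))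

sumFin-zero : ∀ k → sumFin k (λ _ → + 0) ≡ + 0
sumFin-zero zero    = refl
sumFin-zero (suc k) = trans (ℤP.+-identityˡ _) (sumFin-zero k)

sumFin-distrib-+ : ∀ k (f g : Fin k → ℤ) →
  sumFin k (λ i → f i + g i) ≡ sumFin k f + sumFin k g
sumFin-distrib-+ zero    f g = refl
sumFin-distrib-+ (suc k) f g = begin
  f fz + g fz + sumFin k (λ i → f (fs i) + g (fs i))
    ≡⟨ cong (_+_ (f fz + g fz)) (sumFin-distrib-+ k (λ i → f (fs i)) (λ i → g (fs i))) ⟩
  f fz + g fz + (sumFin k (λ i → f (fs i)) + sumFin k (λ i → g (fs i)))
    ≡⟨ interchange (f fz) (g fz) _ _ ⟩
  f fz + sumFin k (λ i → f (fs i)) + (g fz + sumFin k (λ i → g (fs i))) ∎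

sumFin-distrib-- : ∀ k (f g : Fin k → ℤ) →
  sumFin k (λ i → f i - g i) ≡ sumFin k f - sumFin k g
sumFin-distrib-- zero    f g = refl
sumFin-distrib-- (suc k) f g = begin
  f fz - g fz + sumFin k (λ i → f (fs i) - g (fs i))
    ≡⟨ cong (_+_ (f fz - g fz)) (sumFin-distrib-- k (λ i → f (fs i)) (λ i → g (fs i))) ⟩
  f fz - g fz + (sumFin k (λ i → f (fs i)) - sumFin k (λ i → g (fs i)))
    ≡⟨ interchange-- (f fz) (g fz) _ _ ⟩
  f fz + sumFin k (λ i → f (fs i)) - (g fz + sumFin k (λ i → g (fs i))) ∎
  where
  interchange-- : ∀ a b c d → a - b + (c - d) ≡ a + c - (b + d)
  interchange-- = solve-∀

sumFin-*ʳ : ∀ k (f : Fin k → ℤ) c → sumFin k f * c ≡ sumFin k (λ i → f i * c)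
sumFin-*ʳ zero    f c = ℤP.*-zeroˡ c
sumFin-*ʳ (suc k) f c = trans (ℤP.*-distribʳ-+ c (f fz) _)
  (cong (_+_ (f fz * c)) (sumFin-*ʳ k (λ i → f (fs i)) c))

sumFin-comm : ∀ n m (f : Fin n → Fin m → ℤ) →
  sumFin n (λ i → sumFin m (f i)) ≡ sumFin m (λ j → sumFin n (λ i → f i j))
sumFin-comm zero    m f = sym (sumFin-zero m)
sumFin-comm (suc n) m f = begin
  sumFin m (f fz) + sumFin n (λ i → sumFin m (f (fs i)))
    ≡⟨ cong (_+_ (sumFin m (f fz))) (sumFin-comm n m (λ i → f (fs i))) ⟩
  sumFin m (f fz) + sumFin m (λ j → sumFin n (λ i → f (fs i) j))
    ≡⟨ sym (sumFin-distrib-+ m (f fz) _) ⟩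
  sumFin m (λ j → f fz j + sumFin n (λ i → f (fs i) j)) ∎

==-fs : ∀ {k} (u v : Fin k) → fs u == fs v ≡ u == v
==-fs u v with u ≟ᶠ v
... | yes _ = refl
... | no  _ = refl

sumFin-indicator : ∀ k (u : Fin k) (f : Fin k → ℤ) →
  sumFin k (λ v → [ u == v ] * f v) ≡ f u
sumFin-indicator (suc k) fz f = begin
  + 1 * f fz + sumFin k (λ v → + 0 * f (fs v))
    ≡⟨ cong₂ _+_ (ℤP.*-identityˡ (f fz)) (sumFin-cong k (λ v → ℤP.*-zeroˡ (f (fs v)))) ⟩
  f fz + sumFin k (λ _ → + 0)
    ≡⟨ cong (_+_ (f fz)) (sumFin-zero k) ⟩
  f fz + + 0
    ≡⟨ ℤP.+-identityʳ (f fz) ⟩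
  f fz ∎
sumFin-indicator (suc k) (fs u) f = begin
  + 0 * f fz + sumFin k (λ v → [ fs u == fs v ] * f (fs v))
    ≡⟨ cong₂ _+_ (ℤP.*-zeroˡ (f fz))
         (sumFin-cong k (λ v → cong (λ b → [ b ] * f (fs v)) (==-fs u v))) ⟩
  + 0 + sumFin k (λ v → [ u == v ] * f (fs v))
    ≡⟨ ℤP.+-identityˡ _ ⟩
  sumFin k (λ v → [ u == v ] * f (fs v))
    ≡⟨ sumFin-indicator k u (λ v → f (fs v)) ⟩
  f (fs u) ∎

sumFin-indicator-+ : ∀ k (a b : Fin k) (f : Fin k → ℤ) →
  sumFin k (λ v → ([ a == v ] + [ b == v ]) * f v) ≡ f a + f b
sumFin-indicator-+ k a b f = begin
  sumFin k (λ v → ([ a == v ] + [ b == v ]) * f v)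
    ≡⟨ sumFin-cong k (λ v → ℤP.*-distribʳ-+ (f v) [ a == v ] [ b == v ]) ⟩
  sumFin k (λ v → [ a == v ] * f v + [ b == v ] * f v)
    ≡⟨ sumFin-distrib-+ k _ _ ⟩
  sumFin k (λ v → [ a == v ] * f v) + sumFin k (λ v → [ b == v ] * f v)
    ≡⟨ cong₂ _+_ (sumFin-indicator k a f) (sumFin-indicator k b f) ⟩
  f a + f b ∎

sumFin-indicator-- : ∀ k (a b : Fin k) (f : Fin k → ℤ) →
  sumFin k (λ v → ([ a == v ] - [ b == v ]) * f v) ≡ f a - f b
sumFin-indicator-- k a b f = begin
  sumFin k (λ v → ([ a == v ] - [ b == v ]) * f v)
    ≡⟨ sumFin-cong k (λ v → distribʳ-- [ a == v ] [ b == v ] (f v)) ⟩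
  sumFin k (λ v → [ a == v ] * f v - [ b == v ] * f v)
    ≡⟨ sumFin-distrib-- k _ _ ⟩
  sumFin k (λ v → [ a == v ] * f v) - sumFin k (λ v → [ b == v ] * f v)
    ≡⟨ cong₂ _-_ (sumFin-indicator k a f) (sumFin-indicator k b f) ⟩
  f a - f b ∎
  where
  distribʳ-- : ∀ x y z → (x - y) * z ≡ x * z - y * z
  distribʳ-- = solve-∀

if-then-0 : ∀ s (x : ℤ) → (if s then x else + 0) ≡ x * [ s ]
if-then-0 true  x = sym (ℤP.*-identityʳ x)
if-then-0 false x = sym (ℤP.*-zeroʳ x)

cut-parity : ∀ subdivided a b t → ∃[ h ]
  (if subdivided then [ a ≠ᵇ t ] + [ b ≠ᵇ t ] else [ a ≠ᵇ b ]) ≡ [ a ] + [ b ] + h * + 2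
cut-parity true  true  true  true  = -[1+ 0 ] , refl
cut-parity true  true  true  false = + 0 , refl
cut-parity true  true  false true  = + 0 , refl
cut-parity true  true  false false = + 0 , refl
cut-parity true  false true  true  = + 0 , refl
cut-parity true  false true  false = + 0 , refl
cut-parity true  false false true  = + 1 , refl
cut-parity true  false false false = + 0 , refl
cut-parity false true  true  t     = -[1+ 0 ] , refl
cut-parity false true  false t     = + 0 , refl
cut-parity false false true  t     = + 0 , refl
cut-parity false false false t     = + 0 , refl

SlackBound : Bool → ℤ → Set
SlackBound s x = if s then + 0 ≤ x else + 0 < x

slackBound-move : ∀ sa sb k →
  SlackBound sa (+ 2 * k) → SlackBound sb (+ 2 * k + + 2 * ([ sa ] - [ sb ]))
slackBound-move true  true  k 0≤2k = subst (+ 0 ≤_) (sym (ℤP.+-identityʳ _)) 0≤2k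
slackBound-move false false k 0<2k = subst (+ 0 <_) (sym (ℤP.+-identityʳ _)) 0<2k
slackBound-move true  false k 0≤2k = ℤP.+-mono-≤-< 0≤2k (ℤ.+<+ (ℕ.s≤s ℕ.z≤n))
slackBound-move false true  k 0<2k = positive-even k 0<2k
  where
  positive-even : ∀ k → + 0 < + 2 * k → + 0 ≤ + 2 * k + + 2 * (+ 0 - + 1)
  positive-even (+ zero)  (ℤ.+<+ ())
  positive-even -[1+ n ]  ()
  positive-even (+ suc n) _ =
    subst (+ 0 ≤_) (trans (ℤP.pos-* 2 n) (sym (drop-one (+ n)))) (ℤ.+≤+ ℕ.z≤n)
    where
    drop-one : ∀ m → + 2 * (+ 1 + m) + + 2 * (+ 0 - + 1) ≡ + 2 * m
    drop-one = solve-∀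

module _ (Γ : Graph) where
  open Graph Γ

  slack : (P : PseudoDivisor Γ) → VSubset Γ P → ℤ
  slack P V = + 2 * DV Γ P V - twoμV Γ P V + δ Γ P V

  module _ {P : PseudoDivisor Γ} (V : VSubset Γ P) where
    open VSubset V

    endsInV : ℤ
    endsInV = sumFin nE (λ e → [ S (src e) ] + [ S (tgt e) ])

    twoμV-ends : ∃[ a ] twoμV Γ P V ≡ a * + 2 + endsInV
    twoμV-ends = sumFin nV (λ v → (+ w v - + 1) * [ S v ]) , (begin
      sumFin nV (λ v → if S v then twoμ Γ v else + 0)
        ≡⟨ sumFin-cong nV (λ v → trans (if-then-0 (S v) (twoμ Γ v)) (twoμ-masked v)) ⟩
      sumFin nV (λ v → (+ w v - + 1) * [ S v ] * + 2 + val Γ v * [ S v ])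
        ≡⟨ sumFin-distrib-+ nV _ _ ⟩
      sumFin nV (λ v → (+ w v - + 1) * [ S v ] * + 2) + sumFin nV (λ v → val Γ v * [ S v ])
        ≡⟨ cong₂ _+_ (sym (sumFin-*ʳ nV _ (+ 2)))
             (sumFin-cong nV (λ v → sumFin-*ʳ nE _ [ S v ])) ⟩
      sumFin nV (λ v → (+ w v - + 1) * [ S v ]) * + 2
        + sumFin nV (λ v → sumFin nE (λ e → ([ src e == v ] + [ tgt e == v ]) * [ S v ]))
        ≡⟨ cong (_+_ (sumFin nV (λ v → (+ w v - + 1) * [ S v ]) * + 2))
             (trans (sumFin-comm nV nE _)
                    (sumFin-cong nE (λ e → sumFin-indicator-+ nV (src e) (tgt e) (λ v → [ S v ])))) ⟩
      sumFin nV (λ v → (+ w v - + 1) * [ S v ]) * + 2 + endsInV ∎)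
      where
      expand : ∀ w val s → (+ 2 * w - + 2 + val) * s ≡ (w - + 1) * s * + 2 + val * s
      expand = solve-∀
      twoμ-masked : ∀ v → twoμ Γ v * [ S v ] ≡ (+ w v - + 1) * [ S v ] * + 2 + val Γ v * [ S v ]
      twoμ-masked v = expand (+ w v) (val Γ v) [ S v ]

    δ-ends : ∃[ h ] δ Γ P V ≡ endsInV + h * + 2
    δ-ends = sumFin nE (λ e → proj₁ (parity e)) , (begin
      δ Γ P V
        ≡⟨ sumFin-cong nE (λ e → proj₂ (parity e)) ⟩
      sumFin nE (λ e → [ S (src e) ] + [ S (tgt e) ] + proj₁ (parity e) * + 2)
        ≡⟨ sumFin-distrib-+ nE _ _ ⟩
      endsInV + sumFin nE (λ e → proj₁ (parity e) * + 2)
        ≡⟨ cong (_+_ endsInV) (sym (sumFin-*ʳ nE _ (+ 2))) ⟩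
      endsInV + sumFin nE (λ e → proj₁ (parity e)) * + 2 ∎)
      where
      parity : ∀ e → ∃[ h ] (if lookup (ℰ P) e
                               then [ S (src e) ≠ᵇ T e ] + [ S (tgt e) ≠ᵇ T e ]
                               else [ S (src e) ≠ᵇ S (tgt e) ])
                            ≡ [ S (src e) ] + [ S (tgt e) ] + h * + 2
      parity e = cut-parity (lookup (ℰ P) e) (S (src e)) (S (tgt e)) (T e)

    slack-even : ∃[ k ] slack P V ≡ + 2 * k
    slack-even with twoμV-ends | δ-ends
    ... | a , twoμV≡ | h , δ≡ = DV Γ P V - a + h , (begin
      + 2 * DV Γ P V - twoμV Γ P V + δ Γ P V
        ≡⟨ cong₂ (λ x y → + 2 * DV Γ P V - x + y) twoμV≡ δ≡ ⟩
      + 2 * DV Γ P V - (a * + 2 + endsInV) + (endsInV + h * + 2)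
        ≡⟨ cancel-ends (DV Γ P V) a endsInV h ⟩
      + 2 * (DV Γ P V - a + h) ∎)
      where
      cancel-ends : ∀ d a b h → + 2 * d - (a * + 2 + b) + (b + h * + 2) ≡ + 2 * (d - a + h)
      cancel-ends = solve-∀

  shift : Fin nV → Fin nV → PseudoDivisor Γ → PseudoDivisor Γ
  shift a b P = pd (ℰ P) (tabulate (λ v → lookup (D P) v + ([ a == v ] - [ b == v ])))

  lookup-shift : ∀ a b P v →
    lookup (D (shift a b P)) v ≡ lookup (D P) v + ([ a == v ] - [ b == v ])
  lookup-shift a b P v = lookup∘tabulate _ v

  shift-inverse : ∀ a b P → shift b a (shift a b P) ≡ P
  shift-inverse a b (pd ℰ₀ D₀) = cong (pd ℰ₀) (begin
    tabulate (λ v → lookup (D (shift a b (pd ℰ₀ D₀))) v + ([ b == v ] - [ a == v ]))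
      ≡⟨ tabulate-cong (λ v → trans (cong (_+ ([ b == v ] - [ a == v ])) (lookup-shift a b (pd ℰ₀ D₀) v))
                                    (cancel (lookup D₀ v) [ a == v ] [ b == v ])) ⟩
    tabulate (lookup D₀)
      ≡⟨ tabulate∘lookup D₀ ⟩
    D₀ ∎)
    where
    cancel : ∀ d p q → d + (p - q) + (q - p) ≡ d
    cancel = solve-∀

  degree-shift : ∀ a b P → degree Γ (shift a b P) ≡ degree Γ P
  degree-shift a b P = cong (_+ countFin nE (lookup (ℰ P))) (begin
    sumFin nV (lookup (D (shift a b P)))
      ≡⟨ sumFin-cong nV (λ v → trans (lookup-shift a b P v) (cong (_+_ (lookup (D P) v))
                                      (sym (ℤP.*-identityʳ ([ a == v ] - [ b == v ]))))) ⟩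
    sumFin nV (λ v → lookup (D P) v + ([ a == v ] - [ b == v ]) * + 1)
      ≡⟨ sumFin-distrib-+ nV _ _ ⟩
    sumFin nV (lookup (D P)) + sumFin nV (λ v → ([ a == v ] - [ b == v ]) * + 1)
      ≡⟨ cong (_+_ (sumFin nV (lookup (D P)))) (sumFin-indicator-- nV a b (λ _ → + 1)) ⟩
    sumFin nV (lookup (D P)) + + 0
      ≡⟨ ℤP.+-identityʳ _ ⟩
    sumFin nV (lookup (D P)) ∎)

  unshift : ∀ a b P → VSubset Γ (shift a b P) → VSubset Γ P
  unshift a b P V = record { VSubset V }

  DV-shift : ∀ a b P (V : VSubset Γ (shift a b P)) → let open VSubset V in
    DV Γ (shift a b P) V ≡ DV Γ P (unshift a b P V) + ([ S a ] - [ S b ])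
  DV-shift a b P V = begin
    sumFin nV (λ v → if S v then lookup (D (shift a b P)) v else + 0) + countFin nE T
      ≡⟨ cong (_+ countFin nE T) (begin
        sumFin nV (λ v → if S v then lookup (D (shift a b P)) v else + 0)
          ≡⟨ sumFin-cong nV masked-shift ⟩
        sumFin nV (λ v → lookup (D P) v * [ S v ] + ([ a == v ] - [ b == v ]) * [ S v ])
          ≡⟨ sumFin-distrib-+ nV _ _ ⟩
        sumFin nV (λ v → lookup (D P) v * [ S v ])
          + sumFin nV (λ v → ([ a == v ] - [ b == v ]) * [ S v ])
          ≡⟨ cong₂ _+_ (sumFin-cong nV (λ v → sym (if-then-0 (S v) (lookup (D P) v))))
                       (sumFin-indicator-- nV a b (λ v → [ S v ])) ⟩
        sumFin nV (λ v → if S v then lookup (D P) v else + 0) + ([ S a ] - [ S b ]) ∎) ⟩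
    sumFin nV (λ v → if S v then lookup (D P) v else + 0) + ([ S a ] - [ S b ]) + countFin nE T
      ≡⟨ xy∙z≈xz∙y (sumFin nV (λ v → if S v then lookup (D P) v else + 0)) _ _ ⟩
    DV Γ P (unshift a b P V) + ([ S a ] - [ S b ]) ∎
    where
    open VSubset V
    masked-shift : ∀ v → (if S v then lookup (D (shift a b P)) v else + 0)
                         ≡ lookup (D P) v * [ S v ] + ([ a == v ] - [ b == v ]) * [ S v ]
    masked-shift v = begin
      (if S v then lookup (D (shift a b P)) v else + 0)
        ≡⟨ if-then-0 (S v) _ ⟩
      lookup (D (shift a b P)) v * [ S v ]
        ≡⟨ cong (_* [ S v ]) (lookup-shift a b P v) ⟩
      (lookup (D P) v + ([ a == v ] - [ b == v ])) * [ S v ]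
        ≡⟨ ℤP.*-distribʳ-+ [ S v ] (lookup (D P) v) _ ⟩
      lookup (D P) v * [ S v ] + ([ a == v ] - [ b == v ]) * [ S v ] ∎

  slack-shift : ∀ a b P (V : VSubset Γ (shift a b P)) → let open VSubset V in
    slack (shift a b P) V ≡ slack P (unshift a b P V) + + 2 * ([ S a ] - [ S b ])
  slack-shift a b P V =
    trans (cong (λ d → + 2 * d - twoμV Γ P V' + δ Γ P V') (DV-shift a b P V))
          (rearrange (DV Γ P V') _ _ _)
    where
    V' : VSubset Γ P
    V' = unshift a b P V
    rearrange : ∀ d s t u → + 2 * (d + s) - t + u ≡ + 2 * d - t + u + + 2 * s
    rearrange = solve-∀

  shiftQD : ∀ a b → QD Γ a → QD Γ b
  shiftQD a b (P , deg≡ , quasistable) = shift a b P , trans (degree-shift a b P) deg≡ , λ V →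
    let open VSubset V
        (k , slack≡2k) = slack-even (unshift a b P V)
    in subst (SlackBound (S b)) (sym (trans (slack-shift a b P V) (cong (_+ _) slack≡2k)))
         (slackBound-move (S a) (S b) k (subst (SlackBound (S a)) slack≡2k (quasistable (unshift a b P V))))

  shift-mono : ∀ a b P P' → _≥PD_ Γ P P' → _≥PD_ Γ (shift a b P) (shift a b P')
  shift-mono a b P P' (ℰ'⊆ℰ , c , D'≡) = ℰ'⊆ℰ , c , λ v → begin
    lookup (D (shift a b P')) v           ≡⟨ lookup-shift a b P' v ⟩
    lookup (D P') v + moved v             ≡⟨ cong (_+ moved v) (D'≡ v) ⟩
    lookup (D P) v + contracted v + moved v
      ≡⟨ xy∙z≈xz∙y (lookup (D P) v) (contracted v) (moved v) ⟩
    lookup (D P) v + moved v + contracted v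
      ≡⟨ cong (_+ contracted v) (sym (lookup-shift a b P v)) ⟩
    lookup (D (shift a b P)) v + contracted v ∎
    where
    moved : Fin nV → ℤ
    moved v = [ a == v ] - [ b == v ]
    contracted : Fin nV → ℤ
    contracted v = countFin nE (λ e → lookup (ℰ P) e ∧ not (lookup (ℰ P') e) ∧
                                      ((if c e then src e else tgt e) == v))

proposition3p4 : (Γ : Graph) (v₀ v₁ : Fin (Graph.nV Γ)) → QDIso Γ v₀ v₁
proposition3p4 Γ v₀ v₁ = record
  { to      = shiftQD Γ v₀ v₁
  ; from    = shiftQD Γ v₁ v₀
  ; from∘to = λ x → shift-inverse Γ v₀ v₁ (proj₁ x)
  ; to∘from = λ y → shift-inverse Γ v₁ v₀ (proj₁ y)
  ; to-mono = λ x y → shift-mono Γ v₀ v₁ (proj₁ x) (proj₁ y)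
  ; to-refl = λ (P , _) (P' , _) →
      subst₂ (_≥PD_ Γ) (shift-inverse Γ v₀ v₁ P) (shift-inverse Γ v₀ v₁ P')
      ∘ shift-mono Γ v₁ v₀ (shift Γ v₀ v₁ P) (shift Γ v₀ v₁ P')
  }
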